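{- Let $V$ be a finite set with $|V|=l$ and $T:\mathscr{P}(V)\to\mathscr{P}(V)$ a map. If $(E_1,E_2)$ is the unique pair of equivalence relations on $V$ with $T(X)=\mathbf{l}_{E_2}(\mathbf{l}_{E_1}(X))$ for all $X\subseteq V$, and $E_1$ has $n$ classes and $E_2$ has $m$ classes, then $\gamma(E_1,E_2)\le m/l$ and $\gamma(E_2,E_1)\le n/l$.
   Context: For an equivalence relation $E$ on $V$: $\mathbf{l}_E(X)=\{x\in V:[x]_E\subseteq X\}$. For equivalence relations $C,D$ on $V$, the positive region is $POS_C(D)=\bigcup_{X\in V/D}\mathbf{l}_C(X)$ and $\gamma(C,D)=|POS_C(D)|/|V|$. -}

module Defs where

open import Data.Nat using (ℕ; NonZero)
open import Data.Bool using (Bool; true; false; _∧_; _∨_; not; T)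
import Data.Bool as Bool
open import Data.Fin using (Fin)
open import Data.Fin.Subset using (Subset; ⊥; _∪_; ∣_∣)
open import Data.Vec using (tabulate; lookup)
open import Data.Vec.Properties using (≡-dec)
open import Data.List using (List; map; foldr; length; allFin; deduplicate)
open import Data.Bool.ListAction using (and)
open import Data.Integer using (+_)
open import Data.Rational using (ℚ; _/_)
open import Relation.Binary.Structures using (IsEquivalence)
open import Relation.Binary.PropositionalEquality using (_≡_)
open import Data.Product using (_×_)


BRel : ℕ → Set
BRel l = Fin l → Fin l → Bool

record EqRel (l : ℕ) : Set where
  field
    rel   : BRel l
    isEqv : IsEquivalence (λ x y → T (rel x y))
open EqRel public

class : ∀ {l} → EqRel l → Fin l → Subset l
class E x = tabulate (λ y → rel E x y)

lower : ∀ {l} → EqRel l → Subset l → Subset l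
lower {l} E X = tabulate (λ x →
  and (map (λ y → not (rel E x y) ∨ lookup X y) (allFin l)))

quotient : ∀ {l} → EqRel l → List (Subset l)
quotient {l} E = deduplicate (≡-dec Bool._≟_) (map (class E) (allFin l))

numClasses : ∀ {l} → EqRel l → ℕ
numClasses E = length (quotient E)

POS : ∀ {l} → EqRel l → EqRel l → Subset l
POS C D = foldr (λ X acc → lower C X ∪ acc) ⊥ (quotient D)

γ : ∀ {l} .{{_ : NonZero l}} → EqRel l → EqRel l → ℚ
γ {l} C D = (+ ∣ POS C D ∣) / l

SameRel : ∀ {l} → EqRel l → EqRel l → Set
SameRel {l} E F = ∀ (x y : Fin l) → rel E x y ≡ rel F x y

Represents : ∀ {l} → (Subset l → Subset l) → EqRel l → EqRel l → Set
Represents {l} Tm E₁ E₂ = ∀ (X : Subset l) → Tm X ≡ lower E₂ (lower E₁ X)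

UniquePair : ∀ {l} → (Subset l → Subset l) → EqRel l → EqRel l → Set
UniquePair {l} Tm E₁ E₂ =
  Represents Tm E₁ E₂ ×
  (∀ (F₁ F₂ : EqRel l) → Represents Tm F₁ F₂ → SameRel F₁ E₁ × SameRel F₂ E₂)

-- A pair (E₁, E₂) that is the only one representing T is rigid: any F with
-- F ⊆ E₁ ∪ E₂ and E₁ ⊆ F ∪ E₂ yields the same composite lower approximation,
-- hence F = E₁ (and symmetrically for E₂). If [x]_{E₁} ⊆ [x]_{E₂}, splitting x
-- off its E₁-class is such a perturbation, so [x]_{E₁} = {x}; merging two such
-- points that are E₂-related is another, so they coincide. Hence POS_{E₁}(E₂)
-- meets every E₂-class in at most one point and |POS_{E₁}(E₂)| ≤ m.
module Submission where

open import Defs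
open import Data.Nat using (ℕ; NonZero)
open import Data.Fin.Subset using (Subset)
open import Data.Integer using (+_)
open import Data.Rational using (_/_; _≤_)
open import Data.Product using (_×_)
open import Relation.Binary.PropositionalEquality using (_≡_)

open import Data.Bool using (Bool; true; false; T; not; _∧_; _∨_; if_then_else_)
import Data.Bool as Bool
open import Data.Bool.Properties using (T-∧; T-≡)
open import Data.Empty using (⊥-elim)
open import Data.Fin using (Fin; zero; suc; _≟_)
open import Data.Fin.Properties using (suc-injective; 0≢1+n)
open import Data.Fin.Subset using (∣_∣; _∪_; ⊥; _∈_; _⊆_; inside; outside)
open import Data.Fin.Subset.Properties using (⊆-antisym; x∈p∪q⁻; ∉⊥)
open import Data.Integer using (+≤+)
import Data.Integer.Properties as ℤ
open import Data.List using (List; []; _∷_; length; foldr; map; allFin)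
open import Data.List.Membership.Propositional using (find) renaming (_∈_ to _∈ˡ_)
open import Data.List.Membership.Propositional.Properties
  using (∈-allFin; ∈-map⁺; ∈-map⁻; ∈-deduplicate⁺; ∈-deduplicate⁻)
open import Data.List.Properties using (length-removeAt′)
open import Data.List.Relation.Unary.All as All using ()
open import Data.List.Relation.Unary.All.Properties using (all⁺; all⁻)
open import Data.List.Relation.Unary.Any as Any using (Any; _─_)
open import Data.Nat as ℕ using (suc; z≤n; s≤s)
import Data.Nat.Properties as ℕ
open import Data.Product using (∃; _,_; proj₁; proj₂)
open import Data.Rational using (toℚᵘ)
open import Data.Rational.Properties using (toℚᵘ-cancel-≤; toℚᵘ-fromℚᵘ)
import Data.Rational.Unnormalised as ℚᵘ
import Data.Rational.Unnormalised.Properties as ℚᵘ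
open import Data.Sum as Sum using (_⊎_; inj₁; inj₂)
open import Data.Vec as Vec using (lookup; tabulate; here; there)
open import Data.Vec.Properties using (≡-dec; lookup∘tabulate; []=⇒lookup; lookup⇒[]=)
open import Function using (_∘_)
open import Function.Bundles using (Equivalence)
open import Relation.Binary.PropositionalEquality
  using (_≢_; refl; sym; trans; cong; subst; module ≡-Reasoning)
open import Relation.Binary.Structures using (IsEquivalence)
open import Relation.Nullary using (Dec; yes; no; does)
open import Relation.Nullary.Decidable
  using (⌊_⌋; isYes≗does; dec-true; dec-false; toWitness; fromWitness)

private
  variable
    l : ℕ

_∼[_]_ : Fin l → EqRel l → Fin l → Set
x ∼[ E ] y = T (rel E x y)

module _ (E : EqRel l) where

  ∼-refl : ∀ {x} → x ∼[ E ] x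
  ∼-refl = IsEquivalence.refl (isEqv E)

  ∼-sym : ∀ {x y} → x ∼[ E ] y → y ∼[ E ] x
  ∼-sym = IsEquivalence.sym (isEqv E)

  ∼-trans : ∀ {x y z} → x ∼[ E ] y → y ∼[ E ] z → x ∼[ E ] z
  ∼-trans = IsEquivalence.trans (isEqv E)

  ∼-resp₂ : ∀ {u u′ v v′} → u ≡ u′ → v ≡ v′ → u ∼[ E ] v → u′ ∼[ E ] v′
  ∼-resp₂ refl refl u∼v = u∼v

∈-tabulate⁺ : {f : Fin l → Bool} {x : Fin l} → T (f x) → x ∈ tabulate f
∈-tabulate⁺ {f = f} {x} fx = lookup⇒[]= x (tabulate f)
  (trans (lookup∘tabulate f x) (Equivalence.to T-≡ fx))

∈-tabulate⁻ : {f : Fin l → Bool} {x : Fin l} → x ∈ tabulate f → T (f x)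
∈-tabulate⁻ {f = f} {x} x∈ = Equivalence.from T-≡
  (trans (sym (lookup∘tabulate f x)) ([]=⇒lookup x∈))

T-impl⁺ : ∀ {a b} → (T a → T b) → T (not a ∨ b)
T-impl⁺ {false}         _ = _
T-impl⁺ {true}  {false} f = f _
T-impl⁺ {true}  {true}  _ = _

T-impl⁻ : ∀ {a b} → T (not a ∨ b) → T a → T b
T-impl⁻ {true} {true} _ _ = _

module _ (E : EqRel l) {X : Subset l} {x : Fin l} where

  ∈-lower⁺ : (∀ {y} → x ∼[ E ] y → y ∈ X) → x ∈ lower E X
  ∈-lower⁺ h = ∈-tabulate⁺ (all⁻ _ {allFin l} (All.tabulate (λ _ →
    T-impl⁺ (Equivalence.from T-≡ ∘ []=⇒lookup ∘ h))))

  ∈-lower⁻ : x ∈ lower E X → ∀ {y} → x ∼[ E ] y → y ∈ X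
  ∈-lower⁻ x∈ {y} x∼y = lookup⇒[]= y X (Equivalence.to T-≡ (T-impl⁻
    (All.lookup (all⁺ _ (allFin l) (∈-tabulate⁻ x∈)) (∈-allFin y)) x∼y))

_⊑_⊔_ : EqRel l → EqRel l → EqRel l → Set
F ⊑ G ⊔ E = ∀ {u v} → u ∼[ F ] v → u ∼[ G ] v ⊎ u ∼[ E ] v

module _ (F G E : EqRel l) (F⊑G⊔E : F ⊑ G ⊔ E) (X : Subset l) where

  lower-antitone-inner : lower E (lower G X) ⊆ lower E (lower F X)
  lower-antitone-inner {w} w∈ = ∈-lower⁺ E λ {u} w∼u → ∈-lower⁺ F λ u∼v →
    case (F⊑G⊔E u∼v) w∼u
    where
    case : ∀ {u v} → u ∼[ G ] v ⊎ u ∼[ E ] v → w ∼[ E ] u → v ∈ X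
    case (inj₁ u∼v) w∼u = ∈-lower⁻ G (∈-lower⁻ E w∈ w∼u) u∼v
    case (inj₂ u∼v) w∼u = ∈-lower⁻ G (∈-lower⁻ E w∈ (∼-trans E w∼u u∼v)) (∼-refl G)

  lower-antitone-outer : lower G (lower E X) ⊆ lower F (lower E X)
  lower-antitone-outer {w} w∈ = ∈-lower⁺ F λ w∼u → ∈-lower⁺ E λ u∼v →
    case (F⊑G⊔E w∼u) u∼v
    where
    case : ∀ {u v} → w ∼[ G ] u ⊎ w ∼[ E ] u → u ∼[ E ] v → v ∈ X
    case (inj₁ w∼u) u∼v = ∈-lower⁻ E (∈-lower⁻ G w∈ w∼u) u∼v
    case (inj₂ w∼u) u∼v = ∈-lower⁻ E (∈-lower⁻ G w∈ (∼-refl G)) (∼-trans E w∼u u∼v)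

Rigid : EqRel l → EqRel l → Set
Rigid {l} A B = (F : EqRel l) → F ⊑ A ⊔ B → A ⊑ F ⊔ B → SameRel F A

module _ (Tm : Subset l → Subset l) (E₁ E₂ : EqRel l) (unique : UniquePair Tm E₁ E₂) where

  uniquePair⇒rigid₁ : Rigid E₁ E₂
  uniquePair⇒rigid₁ F F⊑ E₁⊑ = proj₁ (proj₂ unique F E₂ λ X →
    trans (proj₁ unique X)
          (⊆-antisym (lower-antitone-inner F E₁ E₂ F⊑ X) (lower-antitone-inner E₁ F E₂ E₁⊑ X)))

  uniquePair⇒rigid₂ : Rigid E₂ E₁
  uniquePair⇒rigid₂ F F⊑ E₂⊑ = proj₂ (proj₂ unique E₁ F λ X →
    trans (proj₁ unique X)
          (⊆-antisym (lower-antitone-outer F E₂ E₁ F⊑ X) (lower-antitone-outer E₂ F E₁ E₂⊑ X)))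

module _ (A : EqRel l) (k : Fin l → Bool) where

  private
    _≈_ : BRel l
    u ≈ v = rel A u v ∧ ⌊ k u Bool.≟ k v ⌋

    ≈⁺ : ∀ {u v} → u ∼[ A ] v → k u ≡ k v → T (u ≈ v)
    ≈⁺ u∼v ku≡kv = Equivalence.from T-∧ (u∼v , fromWitness ku≡kv)

    ≈⁻ : ∀ {u v} → T (u ≈ v) → u ∼[ A ] v × k u ≡ k v
    ≈⁻ u≈v = let u∼v , ku≟kv = Equivalence.to T-∧ u≈v in u∼v , toWitness ku≟kv

  refineBy : EqRel l
  refineBy = record
    { rel   = _≈_
    ; isEqv = record
      { refl  = ≈⁺ (∼-refl A) refl
      ; sym   = λ u≈v → let u∼v , ku≡kv = ≈⁻ u≈v in ≈⁺ (∼-sym A u∼v) (sym ku≡kv)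
      ; trans = λ u≈v v≈w → let u∼v , ku≡kv = ≈⁻ u≈v ; v∼w , kv≡kw = ≈⁻ v≈w in
                            ≈⁺ (∼-trans A u∼v v∼w) (trans ku≡kv kv≡kw)
      }
    }

  ∼-refineBy⁺ : ∀ {u v} → u ∼[ A ] v → k u ≡ k v → u ∼[ refineBy ] v
  ∼-refineBy⁺ = ≈⁺

  ∼-refineBy⁻ : ∀ {u v} → u ∼[ refineBy ] v → u ∼[ A ] v × k u ≡ k v
  ∼-refineBy⁻ = ≈⁻

pullback : EqRel l → (Fin l → Fin l) → EqRel l
pullback A σ = record
  { rel   = λ u v → rel A (σ u) (σ v)
  ; isEqv = record { refl = ∼-refl A ; sym = ∼-sym A ; trans = ∼-trans A }
  }

redirect : Fin l → Fin l → Fin l → Fin l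
redirect y x u = if does (u ≟ y) then x else u

redirect-self : (y x : Fin l) → redirect y x y ≡ x
redirect-self y x = cong (if_then x else y) (dec-true (y ≟ y) refl)

redirect-other : (y x : Fin l) {u : Fin l} → u ≢ y → redirect y x u ≡ u
redirect-other y x {u} u≢y = cong (if_then x else u) (dec-false (u ≟ y) u≢y)

∈-class⁻ : (E : EqRel l) {y z : Fin l} → z ∈ class E y → y ∼[ E ] z
∈-class⁻ E = ∈-tabulate⁻

class-injective : (E : EqRel l) {x y : Fin l} → class E x ≡ class E y → x ∼[ E ] y
class-injective E {x} {y} eq = ∈-class⁻ E (subst (y ∈_) (sym eq) (∈-tabulate⁺ (∼-refl E)))

class∈quotient : (E : EqRel l) (x : Fin l) → class E x ∈ˡ quotient E
class∈quotient E x = ∈-deduplicate⁺ (≡-dec Bool._≟_) (∈-map⁺ (class E) (∈-allFin x))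

∈-quotient⁻ : (E : EqRel l) {X : Subset l} → X ∈ˡ quotient E → ∃ λ y → X ≡ class E y
∈-quotient⁻ {l} E X∈ =
  let y , _ , X≡[y] = ∈-map⁻ (class E)
                        (∈-deduplicate⁻ (≡-dec Bool._≟_) (map (class E) (allFin l)) X∈)
  in y , X≡[y]

∈-⋃lower⁻ : (C : EqRel l) (Ds : List (Subset l)) {x : Fin l} →
            x ∈ foldr (λ X acc → lower C X ∪ acc) ⊥ Ds → Any (λ X → x ∈ lower C X) Ds
∈-⋃lower⁻ C []       x∈ = ⊥-elim (∉⊥ x∈)
∈-⋃lower⁻ C (D ∷ Ds) x∈ =
  Sum.[ Any.here , Any.there ∘ ∈-⋃lower⁻ C Ds ]′ (x∈p∪q⁻ (lower C D) _ x∈)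

ClassIncluded : EqRel l → EqRel l → Fin l → Set
ClassIncluded A B x = ∀ {z} → x ∼[ A ] z → x ∼[ B ] z

∈-POS⁻ : (A B : EqRel l) {x : Fin l} → x ∈ POS A B → ClassIncluded A B x
∈-POS⁻ A B {x} x∈ {z} x∼z with find (∈-⋃lower⁻ A (quotient B) x∈)
... | X , X∈ , x∈lower with ∈-quotient⁻ B X∈
... | y , refl = ∼-trans B (∼-sym B (y∼ (∼-refl A))) (y∼ x∼z)
  where
  y∼ : ∀ {w} → x ∼[ A ] w → y ∼[ B ] w
  y∼ x∼w = ∈-class⁻ B (∈-lower⁻ A x∈lower x∼w)

∈-─⁺ : {B : Set} {y z : B} {ys : List B} (y∈ : y ∈ˡ ys) → z ∈ˡ ys → z ≢ y → z ∈ˡ (ys ─ y∈)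
∈-─⁺ (Any.here refl) (Any.here refl) z≢y = ⊥-elim (z≢y refl)
∈-─⁺ (Any.here refl) (Any.there z∈)  _   = z∈
∈-─⁺ (Any.there y∈)  (Any.here refl) _   = Any.here refl
∈-─⁺ (Any.there y∈)  (Any.there z∈)  z≢y = Any.there (∈-─⁺ y∈ z∈ z≢y)

injectiveOn⇒∣∣≤length : {B : Set} {n : ℕ} (S : Subset n) (f : Fin n → B) {ys : List B} →
                        (∀ {i} → i ∈ S → f i ∈ˡ ys) →
                        (∀ {i j} → i ∈ S → j ∈ S → f i ≡ f j → i ≡ j) →
                        ∣ S ∣ ℕ.≤ length ys
injectiveOn⇒∣∣≤length Vec.[]            f mem inj = z≤n
injectiveOn⇒∣∣≤length (outside Vec.∷ S) f mem inj =
  injectiveOn⇒∣∣≤length S (f ∘ suc) (mem ∘ there)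
    (λ i∈ j∈ → suc-injective ∘ inj (there i∈) (there j∈))
injectiveOn⇒∣∣≤length (inside Vec.∷ S)  f {ys} mem inj = begin
  suc ∣ S ∣               ≤⟨ s≤s (injectiveOn⇒∣∣≤length S (f ∘ suc) mem′ inj′) ⟩
  suc (length (ys ─ f₀∈)) ≡⟨ length-removeAt′ ys _ ⟨
  length ys               ∎
  where
  open ℕ.≤-Reasoning

  f₀∈ : f zero ∈ˡ ys
  f₀∈ = mem here

  mem′ : ∀ {i} → i ∈ S → f (suc i) ∈ˡ (ys ─ f₀∈)
  mem′ i∈ = ∈-─⁺ f₀∈ (mem (there i∈)) (0≢1+n ∘ inj here (there i∈) ∘ sym)

  inj′ : ∀ {i j} → i ∈ S → j ∈ S → f (suc i) ≡ f (suc j) → i ≡ j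
  inj′ i∈ j∈ = suc-injective ∘ inj (there i∈) (there j∈)

module _ (A B : EqRel l) (rigid : Rigid A B) where

  rigid⇒singleton : ∀ {x} → ClassIncluded A B x → ∀ {z} → x ∼[ A ] z → z ≡ x
  rigid⇒singleton {x} incl {z} x∼z = toWitness (Equivalence.from T-≡ z-is-x)
    where
    isX : Fin l → Bool
    isX u = ⌊ u ≟ x ⌋

    isX-other : ∀ {u} → u ≢ x → isX u ≡ false
    isX-other {u} u≢x = trans (isYes≗does (u ≟ x)) (dec-false (u ≟ x) u≢x)

    F : EqRel l
    F = refineBy A isX

    F⊑ : F ⊑ A ⊔ B
    F⊑ = inj₁ ∘ proj₁ ∘ ∼-refineBy⁻ A isX

    A⊑ : A ⊑ F ⊔ B
    A⊑ {u} {v} u∼v = cases (u ≟ x) (v ≟ x)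
      where
      cases : Dec (u ≡ x) → Dec (v ≡ x) → u ∼[ F ] v ⊎ u ∼[ B ] v
      cases (yes refl) _          = inj₂ (incl u∼v)
      cases (no _)     (yes refl) = inj₂ (∼-sym B (incl (∼-sym A u∼v)))
      cases (no u≢x)   (no v≢x)   =
        inj₁ (∼-refineBy⁺ A isX u∼v (trans (isX-other u≢x) (sym (isX-other v≢x))))

    z-is-x : isX z ≡ true
    z-is-x = begin
      isX z        ≡⟨ proj₂ (∼-refineBy⁻ A isX (subst T (sym (rigid F F⊑ A⊑ x z)) x∼z)) ⟨
      isX x        ≡⟨ isYes≗does (x ≟ x) ⟩
      does (x ≟ x) ≡⟨ dec-true (x ≟ x) refl ⟩
      true         ∎
      where open ≡-Reasoning

  rigid⇒merge : ∀ {x y} → ClassIncluded A B x → ClassIncluded A B y → x ∼[ B ] y → x ≡ y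
  rigid⇒merge {x} {y} incl-x incl-y x∼y with x ≟ y
  ... | yes x≡y = x≡y
  ... | no  x≢y = sym (rigid⇒singleton incl-x (subst T (rigid F F⊑ A⊑ x y) x∼ᶠy))
    where
    σ : Fin l → Fin l
    σ = redirect y x

    -- y glued onto the A-class of x.
    F : EqRel l
    F = pullback A σ

    x∼ᶠy : x ∼[ F ] y
    x∼ᶠy = ∼-resp₂ A (sym (redirect-other y x x≢y)) (sym (redirect-self y x)) (∼-refl A)

    F⊑ : F ⊑ A ⊔ B
    F⊑ {u} {v} σu∼σv = cases (u ≟ y) (v ≟ y)
      where
      cases : Dec (u ≡ y) → Dec (v ≡ y) → u ∼[ A ] v ⊎ u ∼[ B ] v
      cases (yes refl) (yes refl) = inj₁ (∼-refl A)
      cases (yes refl) (no v≢y)   = inj₂ (∼-trans B (∼-sym B x∼y) (incl-x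
        (∼-resp₂ A (redirect-self y x) (redirect-other y x v≢y) σu∼σv)))
      cases (no u≢y)   (yes refl) = inj₂ (∼-trans B (∼-sym B (incl-x (∼-sym A
        (∼-resp₂ A (redirect-other y x u≢y) (redirect-self y x) σu∼σv)))) x∼y)
      cases (no u≢y)   (no v≢y)   = inj₁
        (∼-resp₂ A (redirect-other y x u≢y) (redirect-other y x v≢y) σu∼σv)

    A⊑ : A ⊑ F ⊔ B
    A⊑ {u} {v} u∼v = cases (u ≟ y) (v ≟ y)
      where
      cases : Dec (u ≡ y) → Dec (v ≡ y) → u ∼[ F ] v ⊎ u ∼[ B ] v
      cases (yes refl) (yes refl) = inj₁ (∼-refl F {y})
      cases (yes refl) (no _)     = inj₂ (incl-y u∼v)
      cases (no _)     (yes refl) = inj₂ (∼-sym B (incl-y (∼-sym A u∼v)))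
      cases (no u≢y)   (no v≢y)   = inj₁
        (∼-resp₂ A (sym (redirect-other y x u≢y)) (sym (redirect-other y x v≢y)) u∼v)

  rigid⇒∣POS∣≤numClasses : ∣ POS A B ∣ ℕ.≤ numClasses B
  rigid⇒∣POS∣≤numClasses = injectiveOn⇒∣∣≤length (POS A B) (class B)
    (λ {x} _ → class∈quotient B x)
    (λ {x} {y} x∈ y∈ →
      rigid⇒merge {x} {y} (∈-POS⁻ A B x∈) (∈-POS⁻ A B y∈) ∘ class-injective B)

/-monoˡ-≤ : ∀ {a b l} .{{_ : NonZero l}} → a ℕ.≤ b → + a / l ≤ + b / l
/-monoˡ-≤ {a} {b} {suc k} a≤b = toℚᵘ-cancel-≤ (begin
  toℚᵘ (+ a / suc k)  ≃⟨ toℚᵘ-fromℚᵘ (ℚᵘ.mkℚᵘ (+ a) k) ⟩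
  ℚᵘ.mkℚᵘ (+ a) k     ≤⟨ ℚᵘ.*≤* (ℤ.*-monoʳ-≤-nonNeg (+ suc k) (+≤+ a≤b)) ⟩
  ℚᵘ.mkℚᵘ (+ b) k     ≃⟨ toℚᵘ-fromℚᵘ (ℚᵘ.mkℚᵘ (+ b) k) ⟨
  toℚᵘ (+ b / suc k)  ∎)
  where open ℚᵘ.≤-Reasoning

mainTheorem8 : ∀ (l : ℕ) .{{_ : NonZero l}} (Tm : Subset l → Subset l) (E₁ E₂ : EqRel l) (n m : ℕ)
    → UniquePair Tm E₁ E₂ → numClasses E₁ ≡ n → numClasses E₂ ≡ m
    → (γ E₁ E₂ ≤ (+ m) / l) × (γ E₂ E₁ ≤ (+ n) / l)
mainTheorem8 l Tm E₁ E₂ n m unique refl refl =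
  /-monoˡ-≤ (rigid⇒∣POS∣≤numClasses E₁ E₂ (uniquePair⇒rigid₁ Tm E₁ E₂ unique)) ,
  /-monoˡ-≤ (rigid⇒∣POS∣≤numClasses E₂ E₁ (uniquePair⇒rigid₂ Tm E₁ E₂ unique))
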